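{- If a connected finite simple graph $G$ has diameter at least $5$, then $d(G)=\infty$ and $G$ accumulates $C_5$ (i.e. $C_5$ is a subgraph of $J^k(G)$ for some $k$).
   Context: The jump graph $J(G)$ has vertex set $E(G)$, two vertices adjacent iff the corresponding edges of $G$ share no endpoint; $J^0(G)=G$, $J^k(G)=J(J^{k-1}(G))$. The dissipation number $d(G)$ is the smallest $k\ge0$ with $J^k(G)$ the empty graph (no vertices), or $\infty$ if none exists. $C_5$ is the 5-cycle. -}

module Defs where

open import Data.Nat using (ℕ; zero; suc; _<_; _<ᵇ_; _%_)
open import Data.Nat.Properties using () renaming (_≟_ to _≟ℕ_)
open import Data.Fin using (Fin; toℕ; zero; suc)
open import Data.Fin.Properties using (_≟_)
open import Data.Bool using (Bool; true; false; _∨_; _∧_; not)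
open import Data.Bool.Properties using (∨-comm; ∨-assoc; ∨-zeroʳ)
open import Data.List using (List; []; _∷_; length; filterᵇ; cartesianProduct)
open import Data.List.Base using (lookup; allFin)
open import Data.Product using (_×_; _,_; proj₁; proj₂; ∃; ∃-syntax; Σ-syntax)
open import Function.Definitions using (Injective)
open import Relation.Nullary.Decidable using (⌊_⌋)
open import Relation.Binary.PropositionalEquality
  using (_≡_; refl; cong; cong₂; sym; trans)
open import Relation.Nullary using (¬_)
open import Data.Empty using (⊥)

record Graph : Set where
  field
    n      : ℕ
    adj    : Fin n → Fin n → Bool
    adj-sym    : ∀ i j → adj i j ≡ adj j i
    adj-irrefl : ∀ i → adj i i ≡ false
open Graph public

IsEmpty : Graph → Set
IsEmpty G = n G ≡ 0

edgeList : (G : Graph) → List (Fin (n G) × Fin (n G))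
edgeList G = filterᵇ (λ p → (toℕ (proj₁ p) <ᵇ toℕ (proj₂ p)) ∧ adj G (proj₁ p) (proj₂ p))
                     (cartesianProduct (allFin (n G)) (allFin (n G)))

share : ∀ {m} → Fin m × Fin m → Fin m × Fin m → Bool
share (a , b) (c , d) = (⌊ a ≟ c ⌋ ∨ ⌊ a ≟ d ⌋) ∨ (⌊ b ≟ c ⌋ ∨ ⌊ b ≟ d ⌋)

private
  ⌊≟⌋-sym : ∀ {m} (a b : Fin m) → ⌊ a ≟ b ⌋ ≡ ⌊ b ≟ a ⌋
  ⌊≟⌋-sym a b with a ≟ b | b ≟ a
  ... | Relation.Nullary.yes _ | Relation.Nullary.yes _ = refl
  ... | Relation.Nullary.no _  | Relation.Nullary.no _  = refl
  ... | Relation.Nullary.yes p | Relation.Nullary.no q  = Data.Empty.⊥-elim (q (sym p))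
  ... | Relation.Nullary.no q  | Relation.Nullary.yes p = Data.Empty.⊥-elim (q (sym p))

  ⌊≟⌋-refl : ∀ {m} (a : Fin m) → ⌊ a ≟ a ⌋ ≡ true
  ⌊≟⌋-refl a with a ≟ a
  ... | Relation.Nullary.yes _ = refl
  ... | Relation.Nullary.no q  = Data.Empty.⊥-elim (q refl)

  swap4 : ∀ x y z w → (x ∨ y) ∨ (z ∨ w) ≡ (x ∨ z) ∨ (y ∨ w)
  swap4 true  y z w = refl
  swap4 false true  true  w = refl
  swap4 false true  false w = refl
  swap4 false false z w = refl

share-sym : ∀ {m} (p q : Fin m × Fin m) → share p q ≡ share q p
share-sym (a , b) (c , d)
  rewrite ⌊≟⌋-sym a c | ⌊≟⌋-sym a d | ⌊≟⌋-sym b c | ⌊≟⌋-sym b d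
  = swap4 ⌊ c ≟ a ⌋ ⌊ d ≟ a ⌋ ⌊ c ≟ b ⌋ ⌊ d ≟ b ⌋

share-refl : ∀ {m} (p : Fin m × Fin m) → share p p ≡ true
share-refl (a , b) rewrite ⌊≟⌋-refl a = refl

J : Graph → Graph
J G = record
  { n = length E
  ; adj = λ k l → not (share (lookup E k) (lookup E l))
  ; adj-sym = λ k l → cong not (share-sym (lookup E k) (lookup E l))
  ; adj-irrefl = λ k → cong not (share-refl (lookup E k))
  }
  where E = edgeList G

J^ : ℕ → Graph → Graph
J^ zero    G = G
J^ (suc k) G = J (J^ k G)

-- d(G) = ∞ : no iterate J^k(G) is the empty graph.
DissipationInfinite : Graph → Set
DissipationInfinite G = ∀ k → ¬ IsEmpty (J^ k G)

data Walk (G : Graph) : Fin (n G) → Fin (n G) → ℕ → Set where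
  here : ∀ u → Walk G u u 0
  step : ∀ {u v w k} → adj G u v ≡ true → Walk G v w k → Walk G u w (suc k)

Connected : Graph → Set
Connected G = ∀ u v → ∃[ k ] Walk G u v k

DistAtLeast : (G : Graph) → Fin (n G) → Fin (n G) → ℕ → Set
DistAtLeast G u v m = ∀ k → k < m → ¬ Walk G u v k

DiameterAtLeast : Graph → ℕ → Set
DiameterAtLeast G m = ∃[ u ] ∃[ v ] DistAtLeast G u v m

IsSubgraph : Graph → Graph → Set
IsSubgraph H G = Σ[ f ∈ (Fin (n H) → Fin (n G)) ]
  (Injective _≡_ _≡_ f × (∀ i j → adj H i j ≡ true → adj G (f i) (f j) ≡ true))

c5adj : Fin 5 → Fin 5 → Bool
c5adj i j = ⌊ (suc (toℕ i)) % 5 ≟ℕ toℕ j ⌋ ∨ ⌊ (suc (toℕ j)) % 5 ≟ℕ toℕ i ⌋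

c5-irrefl : ∀ i → c5adj i i ≡ false
c5-irrefl zero = refl
c5-irrefl (suc zero) = refl
c5-irrefl (suc (suc zero)) = refl
c5-irrefl (suc (suc (suc zero))) = refl
c5-irrefl (suc (suc (suc (suc zero)))) = refl

C5 : Graph
C5 = record
  { n = 5
  ; adj = c5adj
  ; adj-sym = λ i j → ∨-comm (⌊ (suc (toℕ i)) % 5 ≟ℕ toℕ j ⌋) (⌊ (suc (toℕ j)) % 5 ≟ℕ toℕ i ⌋)
  ; adj-irrefl = c5-irrefl
  }

AccumulatesC5 : Graph → Set
AccumulatesC5 G = ∃[ k ] IsSubgraph C5 (J^ k G)

{-# OPTIONS --safe #-}
-- Any path between two vertices at distance at least 5 has at least six vertices, so the
-- path graph P₆ is a subgraph of G.  In J(P₆) the five edges e₀ e₁ e₂ e₃ e₄ of P₆ form the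
-- 5-cycle e₀ e₂ e₄ e₁ e₃, and likewise C₅ ⊆ J(C₅).  Since an embedding H ⊆ G maps disjoint
-- edges to disjoint edges, J is monotone for the subgraph relation; hence C₅ ⊆ J^k(G) for
-- every k ≥ 1, and in particular no iterated jump graph of G is empty.
module Submission where

open import Defs
open import Data.Bool using (Bool; true; false; _∧_; _∨_; not; T?)
open import Data.Bool.Properties using (∨-comm; T-∧; T-∨; T-≡) renaming (_≟_ to _≟ᵇ_)
open import Data.Empty using (⊥-elim)
open import Data.Fin using (Fin; zero; suc; toℕ; inject≤; #_)
open import Data.Fin.Properties using (_≟_; all?; toℕ-injective; toℕ-inject≤; inject≤-injective)
open import Data.List using (List; []; _∷_; length; lookup; cartesianProduct; allFin)
open import Data.List.Membership.Propositional using (_∈_)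
open import Data.List.Membership.Propositional.Properties
  using (∈-lookup; ∈-filter⁺; ∈-filter⁻; ∈-cartesianProduct⁺; ∈-allFin)
open import Data.List.Relation.Unary.All as All using ([]; _∷_)
open import Data.List.Relation.Unary.All.Properties using (¬Any⇒All¬)
open import Data.List.Relation.Unary.Any using (here; there; any?)
open import Data.List.Relation.Unary.Any.Properties using (lookup-index)
open import Data.List.Relation.Unary.Linked using (Linked; [-]; _∷_)
open import Data.List.Relation.Unary.Unique.Propositional using (Unique; []; _∷_)
open import Data.List.Relation.Unary.Unique.Propositional.Properties
  using (filter⁺; cartesianProduct⁺; allFin⁺)
open import Data.Nat using (ℕ; zero; suc; _<_; _≤_; _<ᵇ_; _≡ᵇ_; s≤s)
open import Data.Nat.Properties using (<-cmp; <-asym; <⇒<ᵇ; <ᵇ⇒<; ≡ᵇ⇒≡; ≮⇒≥; suc-injective)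
open import Data.Product using (_×_; _,_; proj₁; proj₂; ∃-syntax; map; swap)
open import Data.Sum using (_⊎_; inj₁; inj₂)
open import Data.Vec using (_∷_; [])
import Data.Vec as Vec
open import Function using (_∘_; Equivalence)
open import Function.Definitions using (Injective)
open import Relation.Binary using (tri<; tri≈; tri>)
open import Relation.Binary.PropositionalEquality
  using (_≡_; refl; sym; trans; cong; cong₂; subst; module ≡-Reasoning)
open import Relation.Nullary using (¬_; Dec; yes; no; contradiction)
open import Relation.Nullary.Decidable
  using (⌊_⌋; isYes≗does; dec-true; dec-false; map′; _×-dec_; _→-dec_; toWitness)

open Equivalence using (to; from)

private
  variable
    A : Set
    G H K : Graph
    m k : ℕ

lookup-injective : {xs : List A} → Unique xs → ∀ i j → lookup xs i ≡ lookup xs j → i ≡ j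
lookup-injective (_ ∷ _) zero zero _ = refl
lookup-injective (x∉xs ∷ _) zero (suc j) eq = ⊥-elim (All.lookup x∉xs (∈-lookup j) eq)
lookup-injective (x∉xs ∷ _) (suc i) zero eq = ⊥-elim (All.lookup x∉xs (∈-lookup i) (sym eq))
lookup-injective (_ ∷ xs!) (suc i) (suc j) eq = cong suc (lookup-injective xs! i j eq)

Linked-lookup : ∀ {R : A → A → Set} {xs} → Linked R xs →
  ∀ i j → suc (toℕ i) ≡ toℕ j → R (lookup xs i) (lookup xs j)
Linked-lookup (r ∷ _) zero (suc zero) _ = r
Linked-lookup (_ ∷ rs) (suc i) (suc j) eq = Linked-lookup rs i j (suc-injective eq)
Linked-lookup (_ ∷ _) zero (suc (suc _)) ()
Linked-lookup [-] zero zero ()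

vertices : ∀ {u v} → Walk G u v k → List (Fin (n G))
vertices (here u) = u ∷ []
vertices (step {u} _ w) = u ∷ vertices w

length-vertices : ∀ {u v} (w : Walk G u v k) → length (vertices w) ≡ suc k
length-vertices (here _) = refl
length-vertices (step _ w) = cong suc (length-vertices w)

vertices-linked : ∀ {u v} (w : Walk G u v k) → Linked (λ a b → adj G a b ≡ true) (vertices w)
vertices-linked (here _) = [-]
vertices-linked (step a (here _)) = a ∷ [-]
vertices-linked (step a w@(step _ _)) = a ∷ vertices-linked w

record Path (G : Graph) (u v : Fin (n G)) : Set where
  field
    {len}  : ℕ
    walk   : Walk G u v len
    unique : Unique (vertices walk)
open Path

suffix : ∀ {x v w} (p : Walk G v w k) → Unique (vertices p) → x ∈ vertices p → Path G x w
suffix (here _) _ (here refl) = record { walk = here _ ; unique = [] ∷ [] }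
suffix p@(step _ _) p! (here refl) = record { walk = p ; unique = p! }
suffix (step _ p) (_ ∷ p!) (there x∈p) = suffix p p! x∈p

toPath : ∀ {u v} → Walk G u v k → Path G u v
toPath (here u) = record { walk = here u ; unique = [] ∷ [] }
toPath {u = u} (step a w) with toPath w
... | p with any? (u ≟_) (vertices (walk p))
...   | yes u∈p = suffix (walk p) (unique p) u∈p
...   | no u∉p  = record { walk = step a (walk p) ; unique = ¬Any⇒All¬ _ u∉p ∷ unique p }

IsSubgraph-trans : IsSubgraph H G → IsSubgraph G K → IsSubgraph H K
IsSubgraph-trans (f , f-inj , f-hom) (g , g-inj , g-hom) =
  g ∘ f , f-inj ∘ g-inj , λ i j → g-hom (f i) (f j) ∘ f-hom i j

consecutive : ℕ → ℕ → Bool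
consecutive a b = (suc a ≡ᵇ b) ∨ (suc b ≡ᵇ a)

1+n≡ᵇn : ∀ a → (suc a ≡ᵇ a) ≡ false
1+n≡ᵇn zero = refl
1+n≡ᵇn (suc a) = 1+n≡ᵇn a

consecutive-irrefl : ∀ a → consecutive a a ≡ false
consecutive-irrefl a = cong₂ _∨_ (1+n≡ᵇn a) (1+n≡ᵇn a)

consecutive⇒ : ∀ a b → consecutive a b ≡ true → suc a ≡ b ⊎ suc b ≡ a
consecutive⇒ a b e with to T-∨ (from T-≡ e)
... | inj₁ a→b = inj₁ (≡ᵇ⇒≡ _ _ a→b)
... | inj₂ b→a = inj₂ (≡ᵇ⇒≡ _ _ b→a)

pathGraph : ℕ → Graph
pathGraph m = record
  { n = m
  ; adj = λ i j → consecutive (toℕ i) (toℕ j)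
  ; adj-sym = λ i j → ∨-comm (suc (toℕ i) ≡ᵇ toℕ j) _
  ; adj-irrefl = λ i → consecutive-irrefl (toℕ i)
  }

pathGraph-mono : m ≤ k → IsSubgraph (pathGraph m) (pathGraph k)
pathGraph-mono m≤k = (λ i → inject≤ i m≤k) , inject≤-injective m≤k m≤k _ _ , hom
  where
  hom : ∀ i j → consecutive (toℕ i) (toℕ j) ≡ true →
        consecutive (toℕ (inject≤ i m≤k)) (toℕ (inject≤ j m≤k)) ≡ true
  hom i j e rewrite toℕ-inject≤ i m≤k | toℕ-inject≤ j m≤k = e

linked⇒pathGraph⊆ : {xs : List (Fin (n G))} →
  Unique xs → Linked (λ a b → adj G a b ≡ true) xs → IsSubgraph (pathGraph (length xs)) G
linked⇒pathGraph⊆ {G} {xs} xs! linked = lookup xs , lookup-injective xs! _ _ , hom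
  where
  hom : ∀ i j → consecutive (toℕ i) (toℕ j) ≡ true → adj G (lookup xs i) (lookup xs j) ≡ true
  hom i j e with consecutive⇒ (toℕ i) (toℕ j) e
  ... | inj₁ i→j = Linked-lookup linked i j i→j
  ... | inj₂ j→i = trans (adj-sym G _ _) (Linked-lookup linked j i j→i)

path⇒pathGraph⊆ : ∀ {u v} (p : Path G u v) → IsSubgraph (pathGraph (suc (len p))) G
path⇒pathGraph⊆ {G} p = subst (λ m → IsSubgraph (pathGraph m) G) (length-vertices (walk p))
  (linked⇒pathGraph⊆ {G} (unique p) (vertices-linked (walk p)))

diameter≥5⇒pathGraph6⊆ : Connected G → DiameterAtLeast G 5 → IsSubgraph (pathGraph 6) G
diameter≥5⇒pathGraph6⊆ {G} connected (u , v , far) =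
  IsSubgraph-trans {pathGraph 6} {pathGraph (suc (len p))} {G}
    (pathGraph-mono (s≤s 5≤len)) (path⇒pathGraph⊆ p)
  where
  p : Path G u v
  p = toPath (proj₂ (connected u v))
  5≤len : 5 ≤ len p
  5≤len = ≮⇒≥ λ len<5 → far (len p) len<5 (walk p)

SameEdge : Fin m × Fin m → Fin m × Fin m → Set
SameEdge p q = p ≡ q ⊎ p ≡ swap q

SameEdge-euclidean : {x p q : Fin m × Fin m} → SameEdge x p → SameEdge x q → SameEdge p q
SameEdge-euclidean (inj₁ refl) (inj₁ refl) = inj₁ refl
SameEdge-euclidean (inj₁ refl) (inj₂ refl) = inj₂ refl
SameEdge-euclidean (inj₂ refl) (inj₁ refl) = inj₂ refl
SameEdge-euclidean (inj₂ refl) (inj₂ e)    = inj₁ (cong swap e)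

SameEdge-injective : ∀ {f : Fin m → Fin k} → Injective _≡_ _≡_ f →
  ∀ {p q} → SameEdge (map f f p) (map f f q) → SameEdge p q
SameEdge-injective f-inj (inj₁ e) = inj₁ (cong₂ _,_ (f-inj (cong proj₁ e)) (f-inj (cong proj₂ e)))
SameEdge-injective f-inj (inj₂ e) = inj₂ (cong₂ _,_ (f-inj (cong proj₁ e)) (f-inj (cong proj₂ e)))

SameEdge-ordered : ∀ {p q : Fin m × Fin m} →
  toℕ (proj₁ p) < toℕ (proj₂ p) → toℕ (proj₁ q) < toℕ (proj₂ q) → SameEdge p q → p ≡ q
SameEdge-ordered _ _ (inj₁ p≡q) = p≡q
SameEdge-ordered p< q< (inj₂ refl) = contradiction p< (<-asym q<)

share-swapˡ : (p q : Fin m × Fin m) → share (swap p) q ≡ share p q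
share-swapˡ (a , b) (c , d) = ∨-comm (⌊ b ≟ c ⌋ ∨ ⌊ b ≟ d ⌋) _

share-swapʳ : (p q : Fin m × Fin m) → share p (swap q) ≡ share p q
share-swapʳ (a , b) (c , d) = cong₂ _∨_ (∨-comm ⌊ a ≟ d ⌋ _) (∨-comm ⌊ b ≟ d ⌋ _)

share-cong : {p p′ q q′ : Fin m × Fin m} → SameEdge p p′ → SameEdge q q′ → share p q ≡ share p′ q′
share-cong (inj₁ refl) (inj₁ refl) = refl
share-cong {p′ = p′} {q′ = q′} (inj₁ refl) (inj₂ refl) = share-swapʳ p′ q′
share-cong {p′ = p′} {q′ = q′} (inj₂ refl) (inj₁ refl) = share-swapˡ p′ q′
share-cong {p′ = p′} {q′ = q′} (inj₂ refl) (inj₂ refl) =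
  trans (share-swapˡ p′ (swap q′)) (share-swapʳ p′ q′)

⌊≟⌋-injective : ∀ {f : Fin m → Fin k} → Injective _≡_ _≡_ f → ∀ x y → ⌊ f x ≟ f y ⌋ ≡ ⌊ x ≟ y ⌋
⌊≟⌋-injective {f = f} f-inj x y with x ≟ y
... | yes refl = trans (isYes≗does (f x ≟ f x)) (dec-true (f x ≟ f x) refl)
... | no x≢y   = trans (isYes≗does (f x ≟ f y)) (dec-false (f x ≟ f y) (x≢y ∘ f-inj))

share-injective : ∀ {f : Fin m → Fin k} → Injective _≡_ _≡_ f →
  ∀ p q → share (map f f p) (map f f q) ≡ share p q
share-injective f-inj (a , b) (c , d)
  rewrite ⌊≟⌋-injective f-inj a c | ⌊≟⌋-injective f-inj a d
        | ⌊≟⌋-injective f-inj b c | ⌊≟⌋-injective f-inj b d = refl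

vertexPairs : (G : Graph) → List (Fin (n G) × Fin (n G))
vertexPairs G = cartesianProduct (allFin (n G)) (allFin (n G))

isOrderedEdge : (G : Graph) → Fin (n G) × Fin (n G) → Bool
isOrderedEdge G (a , b) = (toℕ a <ᵇ toℕ b) ∧ adj G a b

edgeList-unique : Unique (edgeList G)
edgeList-unique {G} =
  filter⁺ (T? ∘ isOrderedEdge G) {xs = vertexPairs G} (cartesianProduct⁺ (allFin⁺ _) (allFin⁺ _))

edgeList-sound : ∀ k → let (a , b) = lookup (edgeList G) k in toℕ a < toℕ b × adj G a b ≡ true
edgeList-sound {G} k
  with to T-∧ (proj₂ (∈-filter⁻ (T? ∘ isOrderedEdge G) {xs = vertexPairs G}
                                 (∈-lookup {xs = edgeList G} k)))
... | a<b , ab = <ᵇ⇒< _ _ a<b , to T-≡ ab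

∈-edgeList : ∀ {a b} → toℕ a < toℕ b → adj G a b ≡ true → (a , b) ∈ edgeList G
∈-edgeList {G} {a} {b} a<b ab =
  ∈-filter⁺ (T? ∘ isOrderedEdge G) {xs = vertexPairs G}
    (∈-cartesianProduct⁺ (∈-allFin a) (∈-allFin b)) (from T-∧ (<⇒<ᵇ a<b , from T-≡ ab))

edgeList-complete : ∀ {a b} → adj G a b ≡ true → ∃[ k ] SameEdge (lookup (edgeList G) k) (a , b)
edgeList-complete {G} {a} {b} ab with <-cmp (toℕ a) (toℕ b)
... | tri< a<b _ _ = _ , inj₁ (sym (lookup-index (∈-edgeList {G} a<b ab)))
... | tri> _ _ b<a = _ , inj₂ (sym (lookup-index (∈-edgeList {G} b<a (trans (adj-sym G b a) ab))))
... | tri≈ _ a≡b _ with toℕ-injective a≡b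
...   | refl = contradiction (trans (sym ab) (adj-irrefl G a)) λ ()

J-mono : IsSubgraph H G → IsSubgraph (J H) (J G)
J-mono {H} {G} (f , f-inj , f-hom) = φ , φ-injective , φ-hom
  where
  φ-spec : ∀ k → ∃[ l ] SameEdge (lookup (edgeList G) l) (map f f (lookup (edgeList H) k))
  φ-spec k = edgeList-complete {G} (f-hom _ _ (proj₂ (edgeList-sound {H} k)))

  φ : Fin (n (J H)) → Fin (n (J G))
  φ k = proj₁ (φ-spec k)

  φ-injective : Injective _≡_ _≡_ φ
  φ-injective {k} {l} φk≡φl = lookup-injective (edgeList-unique {H}) k l
    (SameEdge-ordered (proj₁ (edgeList-sound {H} k)) (proj₁ (edgeList-sound {H} l))
      (SameEdge-injective f-inj (SameEdge-euclidean (proj₂ (φ-spec k)) φk-spec-l)))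
    where
    φk-spec-l : SameEdge (lookup (edgeList G) (φ k)) (map f f (lookup (edgeList H) l))
    φk-spec-l rewrite φk≡φl = proj₂ (φ-spec l)

  φ-hom : ∀ k l → adj (J H) k l ≡ true → adj (J G) (φ k) (φ l) ≡ true
  φ-hom k l disjoint = begin
    not (share (lookup (edgeList G) (φ k)) (lookup (edgeList G) (φ l)))
      ≡⟨ cong not (share-cong (proj₂ (φ-spec k)) (proj₂ (φ-spec l))) ⟩
    not (share (map f f (lookup (edgeList H) k)) (map f f (lookup (edgeList H) l)))
      ≡⟨ cong not (share-injective f-inj (lookup (edgeList H) k) (lookup (edgeList H) l)) ⟩
    not (share (lookup (edgeList H) k) (lookup (edgeList H) l))
      ≡⟨ disjoint ⟩
    true ∎
    where open ≡-Reasoning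

IsEmbedding : (H G : Graph) → (Fin (n H) → Fin (n G)) → Set
IsEmbedding H G f = Injective _≡_ _≡_ f × (∀ i j → adj H i j ≡ true → adj G (f i) (f j) ≡ true)

isEmbedding? : (H G : Graph) (f : Fin (n H) → Fin (n G)) → Dec (IsEmbedding H G f)
isEmbedding? H G f = injective? ×-dec homomorphic?
  where
  injective? : Dec (Injective _≡_ _≡_ f)
  injective? = map′ (λ inj → inj _ _) (λ inj _ _ → inj)
    (all? λ i → all? λ j → (f i ≟ f j) →-dec (i ≟ j))
  homomorphic? : Dec (∀ i j → adj H i j ≡ true → adj G (f i) (f j) ≡ true)
  homomorphic? = all? λ i → all? λ j → (adj H i j ≟ᵇ true) →-dec (adj G (f i) (f j) ≟ᵇ true)

-- Edges are indexed in lexicographic order: (0,1) (1,2) (2,3) (3,4) (4,5) for P₆,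
-- and (0,1) (0,4) (1,2) (2,3) (3,4) for C₅.
C5⊆J[pathGraph6] : IsSubgraph C5 (J (pathGraph 6))
C5⊆J[pathGraph6] = f , toWitness {a? = isEmbedding? C5 (J (pathGraph 6)) f} _
  where
  f : Fin 5 → Fin 5
  f = Vec.lookup (# 0 ∷ # 2 ∷ # 4 ∷ # 1 ∷ # 3 ∷ [])

C5⊆J[C5] : IsSubgraph C5 (J C5)
C5⊆J[C5] = f , toWitness {a? = isEmbedding? C5 (J C5) f} _
  where
  f : Fin 5 → Fin 5
  f = Vec.lookup (# 0 ∷ # 3 ∷ # 1 ∷ # 2 ∷ # 4 ∷ [])

C5⊆J^suc : IsSubgraph C5 (J G) → ∀ k → IsSubgraph C5 (J^ (suc k) G)
C5⊆J^suc C5⊆JG zero = C5⊆JG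
C5⊆J^suc {G} C5⊆JG (suc k) =
  IsSubgraph-trans {C5} {J C5} {J^ (suc (suc k)) G}
    C5⊆J[C5] (J-mono {C5} {J^ (suc k) G} (C5⊆J^suc C5⊆JG k))

vertex⇒¬IsEmpty : Fin (n G) → ¬ IsEmpty G
vertex⇒¬IsEmpty v empty with subst Fin empty v
... | ()

mainTheorem11 : (G : Graph) → Connected G → DiameterAtLeast G 5 →
    DissipationInfinite G × AccumulatesC5 G
mainTheorem11 G connected far = dissipation , (1 , C5⊆J^ 0)
  where
  C5⊆JG : IsSubgraph C5 (J G)
  C5⊆JG = IsSubgraph-trans {C5} {J (pathGraph 6)} {J G}
    C5⊆J[pathGraph6] (J-mono {pathGraph 6} {G} (diameter≥5⇒pathGraph6⊆ connected far))

  C5⊆J^ : ∀ k → IsSubgraph C5 (J^ (suc k) G)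
  C5⊆J^ = C5⊆J^suc C5⊆JG

  dissipation : DissipationInfinite G
  dissipation zero = vertex⇒¬IsEmpty {G} (proj₁ far)
  dissipation (suc k) = vertex⇒¬IsEmpty {J^ (suc k) G} (proj₁ (C5⊆J^ k) zero)
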